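{- For every integer $m\ge 3$ there exists a completely uniform nested $2$-$(2^m,4,3)$ design.
   Context: A $2$-$(v,4,\lambda)$ design is a pair $(V,\mathcal{C})$ with $|V|=v$ and $\mathcal{C}$ a collection of $4$-subsets (blocks) such that every $2$-subset of $V$ lies in exactly $\lambda$ blocks. A nested $2$-$(v,4,\lambda)$ design is a pair $(V,\mathscr{C})$ where each element of $\mathscr{C}$ is a partition $\{x,y\mid z,w\}=\{\{x,y\},\{z,w\}\}$ of a $4$-subset of $V$ into two pairs, such that $(V,\{\{x,y,z,w\}:\{x,y\mid z,w\}\in\mathscr{C}\})$ is a $2$-$(v,4,\lambda)$ design (each block partitioned once). The multiplicity of a pair in $\binom{V}{2}$ is the number of elements of $\mathscr{C}$ having it as one of their two parts; the nested design is completely uniform if all pairs in $\binom{V}{2}$ have the same positive multiplicity. -}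

module Defs where

open import Data.Nat using (ℕ; zero; suc; _<_)
open import Data.Fin using (Fin; _≟_)
open import Data.Bool using (Bool; true; false; _∧_; _∨_)
open import Data.List using (List; []; _∷_)
open import Data.Product using (Σ; _×_)
open import Relation.Nullary using (¬_)
open import Relation.Nullary.Decidable using (⌊_⌋)
open import Relation.Binary.PropositionalEquality using (_≡_)

-- A nested block {x,y | z,w}: a 4-subset {x,y,z,w} of the point set Fin v
-- (four pairwise distinct points) partitioned into the pairs {x,y} and {z,w}.
record NestedBlock (v : ℕ) : Set where
  constructor ⟨_,_∣_,_⟩[_,_,_,_,_,_]
  field
    x y z w : Fin v
    x≢y : ¬ x ≡ y
    x≢z : ¬ x ≡ z
    x≢w : ¬ x ≡ w
    y≢z : ¬ y ≡ z
    y≢w : ¬ y ≡ w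
    z≢w : ¬ z ≡ w
open NestedBlock public

count : {A : Set} → (A → Bool) → List A → ℕ
count p [] = 0
count p (a ∷ as) with p a
... | true  = suc (count p as)
... | false = count p as

inBlock : {v : ℕ} → Fin v → NestedBlock v → Bool
inBlock a B = ⌊ a ≟ x B ⌋ ∨ ⌊ a ≟ y B ⌋ ∨ ⌊ a ≟ z B ⌋ ∨ ⌊ a ≟ w B ⌋

pairInBlock : {v : ℕ} → Fin v → Fin v → NestedBlock v → Bool
pairInBlock a b B = inBlock a B ∧ inBlock b B

samePair : {v : ℕ} → Fin v → Fin v → Fin v → Fin v → Bool
samePair a b p q = (⌊ a ≟ p ⌋ ∧ ⌊ b ≟ q ⌋) ∨ (⌊ a ≟ q ⌋ ∧ ⌊ b ≟ p ⌋)

isPart : {v : ℕ} → Fin v → Fin v → NestedBlock v → Bool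
isPart a b B = samePair a b (x B) (y B) ∨ samePair a b (z B) (w B)

-- (Fin v, C) is a nested 2-(v,4,λ) design: the underlying blocks (each
-- partitioned once; C is a multiset, i.e. a list) form a 2-(v,4,λ) design.
IsNestedDesign : (v λ′ : ℕ) → List (NestedBlock v) → Set
IsNestedDesign v λ′ C = (a b : Fin v) → ¬ a ≡ b → count (pairInBlock a b) C ≡ λ′

multiplicity : {v : ℕ} → List (NestedBlock v) → Fin v → Fin v → ℕ
multiplicity C a b = count (isPart a b) C

CompletelyUniform : {v : ℕ} → List (NestedBlock v) → Set
CompletelyUniform {v} C =
  Σ ℕ (λ μ → (0 < μ) × ((a b : Fin v) → ¬ a ≡ b → multiplicity C a b ≡ μ))

-- Identify the points with 𝔽₂ᵐ and fix an orthomorphism θ of 𝔽₂ᵐ: a bijection with θ 0 = 0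
-- such that u ↦ u + θ u is a bijection as well (for m ≥ 2, multiplication by generators of 𝔽₄
-- and 𝔽₈ on blocks of two or three coordinates). For d ≠ 0 the vectors d and θ d span a plane
-- W_d, and every coset of W_d, with x its lexicographically least element, gives the nested
-- block {x, x + d | x + θ d, x + d + θ d}. Distinct points a, b lie in a common coset of W_d iff
-- a + b ∈ {d, θ d, d + θ d}; since d ↦ θ d and d ↦ d + θ d are bijections, this happens for
-- exactly three d, so λ = 3. And {a, b} is a part of such a block iff d = a + b, so every pair
-- has multiplicity 1.

module Submission where

open import Defs

open import Data.Bool as Bool using (Bool; true; false; not; _∧_; _xor_; T; if_then_else_)
open import Data.Bool.Properties
  using (true-xor; ∧-identityʳ; ∧-zeroʳ; xor-assoc; xor-comm; xor-identityˡ; xor-identityʳ; xor-same; T-∧; T-∨)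
open import Data.Empty using (⊥-elim)
open import Data.Fin as Fin using (Fin)
open import Data.Fin.Properties using (2↔Bool; *↔×)
open import Data.List using (List; []; _∷_; _++_; [_])
open import Data.Nat using (ℕ; zero; suc; _+_; _≤_; _^_; s≤s; z≤n)
open import Data.Nat.Properties using (+-commutativeSemigroup)
open import Algebra.Properties.CommutativeSemigroup +-commutativeSemigroup
  using () renaming (interchange to +-interchange)
open import Data.Product as Product using (Σ; _×_; _,_; proj₁; proj₂; ∃; ∃₂)
open import Data.Product.Function.NonDependent.Propositional using (_×-↔_; _×-⇔_)
open import Data.Sum as Sum using (_⊎_; inj₁; inj₂)
open import Data.Sum.Function.Propositional using (_⊎-⇔_)
open import Data.Vec as Vec using (Vec; []; _∷_; zipWith; replicate)
open import Data.Vec.Properties using (≡-dec; zipWith-assoc; zipWith-comm; zipWith-identityˡ; zipWith-identityʳ)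
open import Function using (_∘_)
open import Function.Bundles using (module Equivalence; Inverse; Injection; _↔_; _⇔_; mk↔ₛ′; mk⇔)
open import Function.Properties.Equivalence using (⇔-setoid) renaming (refl to ⇔-refl; trans to ⇔-trans)
open import Function.Properties.Inverse using (↔-sym; ↔-trans; ↔⇒↣)
open import Level using (0ℓ)
open import Relation.Binary.Definitions using (DecidableEquality)
open import Relation.Binary.PropositionalEquality
  using (_≡_; refl; sym; trans; cong; cong₂; subst₂; module ≡-Reasoning)
import Relation.Binary.Reasoning.Setoid
open import Relation.Nullary using (¬_; Dec; yes; no; does; _⊎-dec_; _×-dec_)
open import Relation.Nullary.Decidable
  using (T?; from-yes; map′; ⌊_⌋; toWitness; fromWitness; does-⇔; dec-false)

private
  variable
    m n : ℕ

-- The group 𝔽₂ᵐ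

Bits : ℕ → Set
Bits = Vec Bool

infixl 6 _⊕_
_⊕_ : Bits m → Bits m → Bits m
_⊕_ = zipWith _xor_

𝟎 : Bits m
𝟎 = replicate _ false

infix 4 _≟_
_≟_ : DecidableEquality (Bits m)
_≟_ = ≡-dec Bool._≟_

⊕-assoc : (u v w : Bits m) → (u ⊕ v) ⊕ w ≡ u ⊕ (v ⊕ w)
⊕-assoc = zipWith-assoc xor-assoc

⊕-comm : (u v : Bits m) → u ⊕ v ≡ v ⊕ u
⊕-comm = zipWith-comm xor-comm

⊕-identityˡ : (u : Bits m) → 𝟎 ⊕ u ≡ u
⊕-identityˡ = zipWith-identityˡ xor-identityˡ

⊕-identityʳ : (u : Bits m) → u ⊕ 𝟎 ≡ u
⊕-identityʳ = zipWith-identityʳ xor-identityʳ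

⊕-self : (u : Bits m) → u ⊕ u ≡ 𝟎
⊕-self []      = refl
⊕-self (a ∷ u) = cong₂ _∷_ (xor-same a) (⊕-self u)

⊕-cancelˡ : (u v : Bits m) → u ⊕ (u ⊕ v) ≡ v
⊕-cancelˡ u v = begin
  u ⊕ (u ⊕ v) ≡⟨ ⊕-assoc u u v ⟨
  (u ⊕ u) ⊕ v ≡⟨ cong (_⊕ v) (⊕-self u) ⟩
  𝟎 ⊕ v       ≡⟨ ⊕-identityˡ v ⟩
  v           ∎
  where open ≡-Reasoning

⊕-cancelʳ : (u v : Bits m) → (u ⊕ v) ⊕ v ≡ u
⊕-cancelʳ u v = trans (⊕-comm (u ⊕ v) v) (trans (cong (v ⊕_) (⊕-comm u v)) (⊕-cancelˡ v u))

x⊕y≡z⇒y≡x⊕z : {u v w : Bits m} → u ⊕ v ≡ w → v ≡ u ⊕ w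
x⊕y≡z⇒y≡x⊕z {u = u} {v} refl = sym (⊕-cancelˡ u v)

x⊕y≡𝟎⇒x≡y : {u v : Bits m} → u ⊕ v ≡ 𝟎 → u ≡ v
x⊕y≡𝟎⇒x≡y {u = u} eq = sym (trans (x⊕y≡z⇒y≡x⊕z eq) (⊕-identityʳ u))

x≢y⇒x⊕y≢𝟎 : {u v : Bits m} → ¬ u ≡ v → ¬ u ⊕ v ≡ 𝟎
x≢y⇒x⊕y≢𝟎 u≢v = u≢v ∘ x⊕y≡𝟎⇒x≡y

xy⊕z≡xz⊕y : (u v w : Bits m) → u ⊕ v ⊕ w ≡ u ⊕ w ⊕ v
xy⊕z≡xz⊕y u v w = trans (⊕-assoc u v w) (trans (cong (u ⊕_) (⊕-comm v w)) (sym (⊕-assoc u w v)))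

⊕-interchange : (u v w z : Bits m) → (u ⊕ v) ⊕ (w ⊕ z) ≡ (u ⊕ w) ⊕ (v ⊕ z)
⊕-interchange u v w z = begin
  (u ⊕ v) ⊕ (w ⊕ z) ≡⟨ ⊕-assoc u v (w ⊕ z) ⟩
  u ⊕ (v ⊕ (w ⊕ z)) ≡⟨ cong (u ⊕_) (⊕-assoc v w z) ⟨
  u ⊕ ((v ⊕ w) ⊕ z) ≡⟨ cong (λ t → u ⊕ (t ⊕ z)) (⊕-comm v w) ⟩
  u ⊕ ((w ⊕ v) ⊕ z) ≡⟨ cong (u ⊕_) (⊕-assoc w v z) ⟩
  u ⊕ (w ⊕ (v ⊕ z)) ≡⟨ ⊕-assoc u w (v ⊕ z) ⟨
  (u ⊕ w) ⊕ (v ⊕ z) ∎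
  where open ≡-Reasoning

⊕-cancel-common : (x u v : Bits m) → (x ⊕ u) ⊕ (x ⊕ v) ≡ u ⊕ v
⊕-cancel-common x u v =
  trans (⊕-interchange x u x v) (trans (cong (_⊕ (u ⊕ v)) (⊕-self x)) (⊕-identityˡ (u ⊕ v)))

bits↔fin : ∀ m → Bits m ↔ Fin (2 ^ m)
bits↔fin zero    = mk↔ₛ′ (λ _ → Fin.zero) (λ _ → []) (λ { Fin.zero → refl ; (Fin.suc ()) }) (λ { [] → refl })
bits↔fin (suc m) = ↔-trans uncons↔ (↔-trans (↔-sym 2↔Bool ×-↔ bits↔fin m) (↔-sym *↔×))
  where
  uncons↔ : Bits (suc m) ↔ (Bool × Bits m)
  uncons↔ = mk↔ₛ′ (λ { (a ∷ u) → a , u }) (λ (a , u) → a ∷ u) (λ _ → refl) (λ { (a ∷ u) → refl })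

toFin : Bits m → Fin (2 ^ m)
toFin = Inverse.to (bits↔fin _)

toFin-injective : {u v : Bits m} → toFin u ≡ toFin v → u ≡ v
toFin-injective = Injection.injective (↔⇒↣ (bits↔fin _))

toFin-≡⇔ : {u v : Bits m} → toFin u ≡ toFin v ⇔ u ≡ v
toFin-≡⇔ = mk⇔ toFin-injective (cong toFin)

∀-distinct-via-toFin : (P : Fin (2 ^ m) → Fin (2 ^ m) → Set) →
  (∀ {u v} → ¬ u ≡ v → P (toFin u) (toFin v)) → ∀ i j → ¬ i ≡ j → P i j
∀-distinct-via-toFin {m} P h i j i≢j =
  subst₂ P (strictlyInverseˡ i) (strictlyInverseˡ j)
    (h (i≢j ∘ Injection.injective (↔⇒↣ (↔-sym (bits↔fin m)))))
  where open Inverse (bits↔fin m)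

𝟙 : Bool → ℕ
𝟙 true  = 1
𝟙 false = 0

𝟙-⊎ : {A B : Set} (a? : Dec A) (b? : Dec B) → ¬ (A × B) →
      𝟙 (does (a? ⊎-dec b?)) ≡ 𝟙 (does a?) + 𝟙 (does b?)
𝟙-⊎ (yes a) (yes b) disjoint = ⊥-elim (disjoint (a , b))
𝟙-⊎ (yes _) (no _)  _        = refl
𝟙-⊎ (no _)  (yes _) _        = refl
𝟙-⊎ (no _)  (no _)  _        = refl

𝟙-⇔ : {A B : Set} → A ⇔ B → (a? : Dec A) (b? : Dec B) → 𝟙 (does a?) ≡ 𝟙 (does b?)
𝟙-⇔ A⇔B a? b? = cong 𝟙 (does-⇔ A⇔B a? b?)

∑ : ∀ m → (Bits m → ℕ) → ℕ
∑ zero    f = f []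
∑ (suc m) f = ∑ m (f ∘ (false ∷_)) + ∑ m (f ∘ (true ∷_))

concatAll : ∀ m {A : Set} → (Bits m → List A) → List A
concatAll zero    f = f []
concatAll (suc m) f = concatAll m (f ∘ (false ∷_)) ++ concatAll m (f ∘ (true ∷_))

∑-cong : ∀ m {f g : Bits m → ℕ} → (∀ u → f u ≡ g u) → ∑ m f ≡ ∑ m g
∑-cong zero    f≗g = f≗g []
∑-cong (suc m) f≗g = cong₂ _+_ (∑-cong m (f≗g ∘ (false ∷_))) (∑-cong m (f≗g ∘ (true ∷_)))

∑-zero : ∀ m → ∑ m (λ _ → 0) ≡ 0
∑-zero zero    = refl
∑-zero (suc m) = cong₂ _+_ (∑-zero m) (∑-zero m)

∑-+ : ∀ m (f g : Bits m → ℕ) → ∑ m (λ u → f u + g u) ≡ ∑ m f + ∑ m g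
∑-+ zero    f g = refl
∑-+ (suc m) f g = trans (cong₂ _+_ (∑-+ m _ _) (∑-+ m _ _)) (+-interchange (∑ m _) (∑ m _) (∑ m _) (∑ m _))

∑-δ : ∀ m (c : Bits m) → ∑ m (λ u → 𝟙 (does (u ≟ c))) ≡ 1
∑-δ zero    []          = refl
∑-δ (suc m) (false ∷ c) = cong₂ _+_ (∑-δ m c) (∑-zero m)
∑-δ (suc m) (true  ∷ c) = cong₂ _+_ (∑-zero m) (∑-δ m c)

∑-δ-∧ : ∀ m (c : Bits m) b → ∑ m (λ u → 𝟙 (does (u ≟ c) ∧ b)) ≡ 𝟙 b
∑-δ-∧ m c true  = trans (∑-cong m (λ u → cong 𝟙 (∧-identityʳ (does (u ≟ c))))) (∑-δ m c)
∑-δ-∧ m c false = trans (∑-cong m (λ u → cong 𝟙 (∧-zeroʳ (does (u ≟ c))))) (∑-zero m)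

count-++ : {A : Set} (p : A → Bool) (xs ys : List A) → count p (xs ++ ys) ≡ count p xs + count p ys
count-++ p []       ys = refl
count-++ p (x ∷ xs) ys with p x
... | true  = cong suc (count-++ p xs ys)
... | false = count-++ p xs ys

count-concatAll : ∀ m {A : Set} (p : A → Bool) (f : Bits m → List A) →
                  count p (concatAll m f) ≡ ∑ m (count p ∘ f)
count-concatAll zero    p f = refl
count-concatAll (suc m) p f =
  trans (count-++ p (concatAll m _) (concatAll m _))
        (cong₂ _+_ (count-concatAll m p _) (count-concatAll m p _))

count-if : {A : Set} (p : A → Bool) (b : Bool) (x : A) → count p (if b then [ x ] else []) ≡ 𝟙 (b ∧ p x)
count-if p false x = refl
count-if p true  x with p x
... | true  = refl
... | false = refl

module ⇔-Reasoning = Relation.Binary.Reasoning.Setoid (⇔-setoid 0ℓ)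

T-≟ : {i j : Fin n} → T ⌊ i Fin.≟ j ⌋ ⇔ i ≡ j
T-≟ = mk⇔ toWitness fromWitness

T-inBlock : {i : Fin n} (B : NestedBlock n) →
            T (inBlock i B) ⇔ (i ≡ x B ⊎ i ≡ y B ⊎ i ≡ z B ⊎ i ≡ w B)
T-inBlock B = ⇔-trans T-∨ (T-≟ ⊎-⇔ ⇔-trans T-∨ (T-≟ ⊎-⇔ ⇔-trans T-∨ (T-≟ ⊎-⇔ T-≟)))

T-samePair : {i j p q : Fin n} → T (samePair i j p q) ⇔ ((i ≡ p × j ≡ q) ⊎ (i ≡ q × j ≡ p))
T-samePair = ⇔-trans T-∨ (⇔-trans T-∧ (T-≟ ×-⇔ T-≟) ⊎-⇔ ⇔-trans T-∧ (T-≟ ×-⇔ T-≟))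

T-isPart : {i j : Fin n} (B : NestedBlock n) →
           T (isPart i j B) ⇔ (((i ≡ x B × j ≡ y B) ⊎ (i ≡ y B × j ≡ x B)) ⊎
                               ((i ≡ z B × j ≡ w B) ⊎ (i ≡ w B × j ≡ z B)))
T-isPart B = ⇔-trans T-∨ (T-samePair ⊎-⇔ T-samePair)

∃₂-Bool⇔ : {P : Bool → Bool → Set} →
           (P false false ⊎ P true false ⊎ P false true ⊎ P true true) ⇔ ∃₂ P
∃₂-Bool⇔ {P} = mk⇔ to from
  where
  to : P false false ⊎ P true false ⊎ P false true ⊎ P true true → ∃₂ P
  to (inj₁ p)               = false , false , p
  to (inj₂ (inj₁ p))        = true  , false , p
  to (inj₂ (inj₂ (inj₁ p))) = false , true  , p
  to (inj₂ (inj₂ (inj₂ p))) = true  , true  , p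
  from : ∃₂ P → P false false ⊎ P true false ⊎ P false true ⊎ P true true
  from (false , false , p) = inj₁ p
  from (true  , false , p) = inj₂ (inj₁ p)
  from (false , true  , p) = inj₂ (inj₂ (inj₁ p))
  from (true  , true  , p) = inj₂ (inj₂ (inj₂ p))

-- Planes, their cosets and the blocks they carry

lexMin : Bits m → Bits m → Bits m
lexMin []          []          = []
lexMin (false ∷ u) (false ∷ v) = false ∷ lexMin u v
lexMin (true  ∷ u) (true  ∷ v) = true ∷ lexMin u v
lexMin (false ∷ u) (true  ∷ v) = false ∷ u
lexMin (true  ∷ u) (false ∷ v) = false ∷ v

lexMin-comm : (u v : Bits m) → lexMin u v ≡ lexMin v u
lexMin-comm []          []          = refl
lexMin-comm (false ∷ u) (false ∷ v) = cong (false ∷_) (lexMin-comm u v)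
lexMin-comm (true  ∷ u) (true  ∷ v) = cong (true ∷_) (lexMin-comm u v)
lexMin-comm (false ∷ u) (true  ∷ v) = refl
lexMin-comm (true  ∷ u) (false ∷ v) = refl

lexMin-sel : (u v : Bits m) → lexMin u v ≡ u ⊎ lexMin u v ≡ v
lexMin-sel []          []          = inj₁ refl
lexMin-sel (false ∷ u) (false ∷ v) = Sum.map (cong (false ∷_)) (cong (false ∷_)) (lexMin-sel u v)
lexMin-sel (true  ∷ u) (true  ∷ v) = Sum.map (cong (true ∷_)) (cong (true ∷_)) (lexMin-sel u v)
lexMin-sel (false ∷ u) (true  ∷ v) = inj₁ refl
lexMin-sel (true  ∷ u) (false ∷ v) = inj₂ refl

xor≡false⇒≡ : ∀ {a b} → a xor b ≡ false → a ≡ b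
xor≡false⇒≡ {false} {false} _ = refl
xor≡false⇒≡ {true}  {true}  _ = refl

infixr 7 _·_
_·_ : Bool → Bits m → Bits m
true  · u = u
false · u = 𝟎

·-xor : ∀ α β (u : Bits m) → α · u ⊕ β · u ≡ (α xor β) · u
·-xor true  true  u = ⊕-self u
·-xor true  false u = ⊕-identityʳ u
·-xor false β     u = ⊕-identityˡ (β · u)

module Plane (d e : Bits m) where

  span : Bool → Bool → Bits m
  span α β = α · d ⊕ β · e

  span-+ : ∀ α β α′ β′ → span α β ⊕ span α′ β′ ≡ span (α xor α′) (β xor β′)
  span-+ α β α′ β′ = trans (⊕-interchange (α · d) (β · e) (α′ · d) (β′ · e))
                           (cong₂ _⊕_ (·-xor α α′ d) (·-xor β β′ e))

  span-flip : ∀ α β → span α β ⊕ d ≡ span (not α) β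
  span-flip α β = begin
    span α β ⊕ d                         ≡⟨ cong (span α β ⊕_) (⊕-identityʳ d) ⟨
    span α β ⊕ span true false           ≡⟨ span-+ α β true false ⟩
    span (α xor true) (β xor false)      ≡⟨ cong₂ span (trans (xor-comm α true) (true-xor α)) (xor-identityʳ β) ⟩
    span (not α) β                       ∎
    where open ≡-Reasoning

  Independent : Set
  Independent = ∀ α β → span α β ≡ 𝟎 → α ≡ false × β ≡ false

  infix 4 _∈W _∈W* _∈W*? _∈_+W
  _∈W : Bits m → Set
  u ∈W = ∃₂ λ α β → u ≡ span α β

  _∈W* : Bits m → Set
  u ∈W* = u ≡ d ⊎ u ≡ e ⊎ u ≡ d ⊕ e

  _∈W*? : (u : Bits m) → Dec (u ∈W*)
  u ∈W*? = u ≟ d ⊎-dec u ≟ e ⊎-dec u ≟ d ⊕ e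

  _∈_+W : Bits m → Bits m → Set
  a ∈ x +W = ∃₂ λ α β → a ≡ x ⊕ span α β

  ∈W⇔∈W* : {u : Bits m} → ¬ u ≡ 𝟎 → u ∈W ⇔ u ∈W*
  ∈W⇔∈W* {u} u≢𝟎 = mk⇔ to from
    where
    to : u ∈W → u ∈W*
    to (false , false , eq) = ⊥-elim (u≢𝟎 (trans eq (⊕-self 𝟎)))
    to (true  , false , eq) = inj₁ (trans eq (⊕-identityʳ d))
    to (false , true  , eq) = inj₂ (inj₁ (trans eq (⊕-identityˡ e)))
    to (true  , true  , eq) = inj₂ (inj₂ eq)
    from : u ∈W* → u ∈W
    from (inj₁ eq)        = true , false , trans eq (sym (⊕-identityʳ d))
    from (inj₂ (inj₁ eq)) = false , true , trans eq (sym (⊕-identityˡ e))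
    from (inj₂ (inj₂ eq)) = true , true , eq

  ∈+W-sym : {a x : Bits m} → a ∈ x +W → x ∈ a +W
  ∈+W-sym {x = x} (α , β , refl) = α , β , sym (⊕-cancelʳ x (span α β))

  ∈+W-difference : {a b x : Bits m} → a ∈ x +W → b ∈ x +W ⇔ a ⊕ b ∈W
  ∈+W-difference {a} {b} {x} (α , β , refl) = mk⇔ to from
    where
    to : b ∈ x +W → (x ⊕ span α β) ⊕ b ∈W
    to (α′ , β′ , refl) = α xor α′ , β xor β′ ,
      trans (⊕-cancel-common x (span α β) (span α′ β′)) (span-+ α β α′ β′)
    from : (x ⊕ span α β) ⊕ b ∈W → b ∈ x +W
    from (α′ , β′ , eq) = α xor α′ , β xor β′ ,
      trans (x⊕y≡z⇒y≡x⊕z eq) (trans (⊕-assoc x (span α β) (span α′ β′)) (cong (x ⊕_) (span-+ α β α′ β′)))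

  rep₁ : Bits m → Bits m
  rep₁ y = lexMin y (y ⊕ d)

  rep : Bits m → Bits m
  rep y = lexMin (rep₁ y) (rep₁ (y ⊕ e))

  rep₁-⊕d : ∀ y → rep₁ (y ⊕ d) ≡ rep₁ y
  rep₁-⊕d y = trans (cong (lexMin (y ⊕ d)) (⊕-cancelʳ y d)) (lexMin-comm (y ⊕ d) y)

  rep-⊕d : ∀ y → rep (y ⊕ d) ≡ rep y
  rep-⊕d y = cong₂ lexMin (rep₁-⊕d y) (trans (cong rep₁ (xy⊕z≡xz⊕y y d e)) (rep₁-⊕d (y ⊕ e)))

  rep-⊕e : ∀ y → rep (y ⊕ e) ≡ rep y
  rep-⊕e y =
    trans (cong (lexMin (rep₁ (y ⊕ e)) ∘ rep₁) (⊕-cancelʳ y e)) (lexMin-comm (rep₁ (y ⊕ e)) (rep₁ y))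

  rep-⊕· : {u : Bits m} → (∀ y → rep (y ⊕ u) ≡ rep y) → ∀ α y → rep (y ⊕ α · u) ≡ rep y
  rep-⊕· invariant true  y = invariant y
  rep-⊕· invariant false y = cong rep (⊕-identityʳ y)

  rep-⊕span : ∀ y α β → rep (y ⊕ span α β) ≡ rep y
  rep-⊕span y α β = begin
    rep (y ⊕ (α · d ⊕ β · e)) ≡⟨ cong rep (⊕-assoc y (α · d) (β · e)) ⟨
    rep (y ⊕ α · d ⊕ β · e)   ≡⟨ rep-⊕· rep-⊕e β (y ⊕ α · d) ⟩
    rep (y ⊕ α · d)           ≡⟨ rep-⊕· rep-⊕d α y ⟩
    rep y                     ∎
    where open ≡-Reasoning

  rep₁-∈ : ∀ y → ∃ λ α → rep₁ y ≡ y ⊕ α · d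
  rep₁-∈ y with lexMin-sel y (y ⊕ d)
  ... | inj₁ eq = false , trans eq (sym (⊕-identityʳ y))
  ... | inj₂ eq = true , eq

  rep-∈ : ∀ y → rep y ∈ y +W
  rep-∈ y with lexMin-sel (rep₁ y) (rep₁ (y ⊕ e)) | rep₁-∈ y | rep₁-∈ (y ⊕ e)
  ... | inj₁ eq | α , eq₁ | _      =
    α , false , trans eq (trans eq₁ (cong (y ⊕_) (sym (⊕-identityʳ (α · d)))))
  ... | inj₂ eq | _      | α , eq₁ =
    α , true , trans eq (trans eq₁ (trans (⊕-assoc y e (α · d)) (cong (y ⊕_) (⊕-comm e (α · d)))))

  rep-idem : ∀ y → rep (rep y) ≡ rep y
  rep-idem y with rep-∈ y
  ... | α , β , eq = trans (cong rep eq) (rep-⊕span y α β)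

  canonical⇔ : {a x : Bits m} → (x ≡ rep x × a ∈ x +W) ⇔ x ≡ rep a
  canonical⇔ {a} = mk⇔ to from
    where
    to : ∀ {x} → x ≡ rep x × a ∈ x +W → x ≡ rep a
    to {x} (x≡rep-x , α , β , refl) = trans x≡rep-x (sym (rep-⊕span x α β))
    from : ∀ {x} → x ≡ rep a → x ≡ rep x × a ∈ x +W
    from refl = sym (rep-idem a) , ∈+W-sym (rep-∈ a)

  coset-pair⇔ : {a b x : Bits m} → ¬ a ≡ b →
                (x ≡ rep x × a ∈ x +W × b ∈ x +W) ⇔ (x ≡ rep a × a ⊕ b ∈W*)
  coset-pair⇔ {a} {b} {x} a≢b = mk⇔ to from
    where
    a⊕b≢𝟎 : ¬ a ⊕ b ≡ 𝟎
    a⊕b≢𝟎 = x≢y⇒x⊕y≢𝟎 a≢b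
    to : x ≡ rep x × a ∈ x +W × b ∈ x +W → x ≡ rep a × a ⊕ b ∈W*
    to (canonical , a∈ , b∈) =
      Equivalence.to canonical⇔ (canonical , a∈) ,
      Equivalence.to (∈W⇔∈W* a⊕b≢𝟎) (Equivalence.to (∈+W-difference a∈) b∈)
    from : x ≡ rep a × a ⊕ b ∈W* → x ≡ rep x × a ∈ x +W × b ∈ x +W
    from (x≡rep-a , a⊕b∈) with Equivalence.from canonical⇔ x≡rep-a
    ... | canonical , a∈ =
      canonical , a∈ , Equivalence.from (∈+W-difference a∈) (Equivalence.from (∈W⇔∈W* a⊕b≢𝟎) a⊕b∈)

  partner⇔ : {a b x : Bits m} →
             (∃₂ λ α β → a ≡ x ⊕ span α β × b ≡ x ⊕ span (not α) β) ⇔ (a ∈ x +W × d ≡ a ⊕ b)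
  partner⇔ {a} {b} {x} = mk⇔ to from
    where
    to : (∃₂ λ α β → a ≡ x ⊕ span α β × b ≡ x ⊕ span (not α) β) → a ∈ x +W × d ≡ a ⊕ b
    to (α , β , refl , refl) = (α , β , refl) , (begin
      d                                         ≡⟨ ⊕-cancelˡ (span α β) d ⟨
      span α β ⊕ (span α β ⊕ d)                 ≡⟨ cong (span α β ⊕_) (span-flip α β) ⟩
      span α β ⊕ span (not α) β                 ≡⟨ ⊕-cancel-common x (span α β) (span (not α) β) ⟨
      (x ⊕ span α β) ⊕ (x ⊕ span (not α) β)     ∎)
      where open ≡-Reasoning
    from : a ∈ x +W × d ≡ a ⊕ b → (∃₂ λ α β → a ≡ x ⊕ span α β × b ≡ x ⊕ span (not α) β)
    from ((α , β , refl) , d≡a⊕b) = α , β , refl , (begin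
      b                          ≡⟨ x⊕y≡z⇒y≡x⊕z (sym d≡a⊕b) ⟩
      (x ⊕ span α β) ⊕ d         ≡⟨ ⊕-assoc x (span α β) d ⟩
      x ⊕ (span α β ⊕ d)         ≡⟨ cong (x ⊕_) (span-flip α β) ⟩
      x ⊕ span (not α) β         ∎)
      where open ≡-Reasoning

  coset-part⇔ : {a b x : Bits m} → (x ≡ rep x × a ∈ x +W × d ≡ a ⊕ b) ⇔ (x ≡ rep a × d ≡ a ⊕ b)
  coset-part⇔ = mk⇔
    (λ (canonical , a∈ , d≡a⊕b) → Equivalence.to canonical⇔ (canonical , a∈) , d≡a⊕b)
    (λ (x≡rep-a , d≡a⊕b) → let canonical , a∈ = Equivalence.from canonical⇔ x≡rep-a
                           in canonical , a∈ , d≡a⊕b)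

  module _ (independent : Independent) (x : Bits m) where

    point : Bool → Bool → Fin (2 ^ m)
    point α β = toFin (x ⊕ span α β)

    point-injective : ∀ {α β α′ β′} → point α β ≡ point α′ β′ → α ≡ α′ × β ≡ β′
    point-injective {α} {β} {α′} {β′} eq =
      Product.map xor≡false⇒≡ xor≡false⇒≡ (independent (α xor α′) (β xor β′) span≡𝟎)
      where
      span≡𝟎 : span (α xor α′) (β xor β′) ≡ 𝟎
      span≡𝟎 = begin
        span (α xor α′) (β xor β′)            ≡⟨ span-+ α β α′ β′ ⟨
        span α β ⊕ span α′ β′                 ≡⟨ ⊕-cancel-common x (span α β) (span α′ β′) ⟨
        (x ⊕ span α β) ⊕ (x ⊕ span α′ β′)     ≡⟨ cong (_⊕ (x ⊕ span α′ β′)) (toFin-injective eq) ⟩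
        (x ⊕ span α′ β′) ⊕ (x ⊕ span α′ β′)   ≡⟨ ⊕-self _ ⟩
        𝟎                                     ∎
        where open ≡-Reasoning

    differ-in-α : ∀ α β α′ β′ → ¬ α ≡ α′ → ¬ point α β ≡ point α′ β′
    differ-in-α α β α′ β′ α≢α′ = α≢α′ ∘ proj₁ ∘ point-injective {α} {β} {α′} {β′}

    differ-in-β : ∀ α β α′ β′ → ¬ β ≡ β′ → ¬ point α β ≡ point α′ β′
    differ-in-β α β α′ β′ β≢β′ = β≢β′ ∘ proj₂ ∘ point-injective {α} {β} {α′} {β′}

    block : NestedBlock (2 ^ m)
    block = ⟨ point false false , point true false ∣ point false true , point true true ⟩[
              differ-in-α false false true  false (λ ()) ,
              differ-in-β false false false true  (λ ()) ,
              differ-in-α false false true  true  (λ ()) ,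
              differ-in-α true  false false true  (λ ()) ,
              differ-in-β true  false true  true  (λ ()) ,
              differ-in-α false true  true  true  (λ ()) ]

    inBlock-block : {a : Bits m} → T (inBlock (toFin a) block) ⇔ a ∈ x +W
    inBlock-block {a} = begin
      T (inBlock (toFin a) block)
        ≈⟨ T-inBlock block ⟩
      (toFin a ≡ point false false ⊎ toFin a ≡ point true false ⊎
       toFin a ≡ point false true ⊎ toFin a ≡ point true true)
        ≈⟨ toFin-≡⇔ ⊎-⇔ toFin-≡⇔ ⊎-⇔ toFin-≡⇔ ⊎-⇔ toFin-≡⇔ ⟩
      (a ≡ x ⊕ span false false ⊎ a ≡ x ⊕ span true false ⊎
       a ≡ x ⊕ span false true ⊎ a ≡ x ⊕ span true true)
        ≈⟨ ∃₂-Bool⇔ ⟩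
      a ∈ x +W ∎
      where open ⇔-Reasoning

    isPart-block : {a b : Bits m} → T (isPart (toFin a) (toFin b) block) ⇔ (a ∈ x +W × d ≡ a ⊕ b)
    isPart-block = ⇔-trans (T-isPart block) (⇔-trans (mk⇔ Sum.assocʳ Sum.assocˡ)
                     (⇔-trans (both ⊎-⇔ both ⊎-⇔ both ⊎-⇔ both) (⇔-trans ∃₂-Bool⇔ partner⇔)))
      where
      both : {a b p q : Bits m} → (toFin a ≡ toFin p × toFin b ≡ toFin q) ⇔ (a ≡ p × b ≡ q)
      both = toFin-≡⇔ ×-⇔ toFin-≡⇔

    pairInBlock-canonical : {a b : Bits m} → ¬ a ≡ b →
      does (x ≟ rep x) ∧ pairInBlock (toFin a) (toFin b) block ≡ does (x ≟ rep a) ∧ does (a ⊕ b ∈W*?)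
    pairInBlock-canonical {a} {b} a≢b =
      does-⇔ (⇔-trans (⇔-refl ×-⇔ ⇔-trans T-∧ (inBlock-block ×-⇔ inBlock-block)) (coset-pair⇔ a≢b))
             (x ≟ rep x ×-dec T? _) (x ≟ rep a ×-dec a ⊕ b ∈W*?)

    isPart-canonical : {a b : Bits m} →
      does (x ≟ rep x) ∧ isPart (toFin a) (toFin b) block ≡ does (x ≟ rep a) ∧ does (d ≟ a ⊕ b)
    isPart-canonical {a} {b} =
      does-⇔ (⇔-trans (⇔-refl ×-⇔ isPart-block) coset-part⇔)
             (x ≟ rep x ×-dec T? _) (x ≟ rep a ×-dec d ≟ a ⊕ b)

-- The design of an orthomorphism

record Orthomorphism (m : ℕ) : Set where
  field
    θ θ⁻¹ σ⁻¹ : Bits m → Bits m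
    θ⁻¹∘θ     : ∀ u → θ⁻¹ (θ u) ≡ u
    θ∘θ⁻¹     : ∀ u → θ (θ⁻¹ u) ≡ u
    σ⁻¹∘σ     : ∀ u → σ⁻¹ (u ⊕ θ u) ≡ u
    σ∘σ⁻¹     : ∀ u → σ⁻¹ u ⊕ θ (σ⁻¹ u) ≡ u
    θ-𝟎       : θ 𝟎 ≡ 𝟎

module Construction (o : Orthomorphism m) where
  open Orthomorphism o

  module Π (d : Bits m) = Plane d (θ d)

  σ-𝟎 : 𝟎 ⊕ θ 𝟎 ≡ 𝟎
  σ-𝟎 = trans (⊕-identityˡ (θ 𝟎)) θ-𝟎

  θx≡𝟎⇒x≡𝟎 : ∀ {d} → θ d ≡ 𝟎 → d ≡ 𝟎
  θx≡𝟎⇒x≡𝟎 {d} eq = begin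
    d          ≡⟨ θ⁻¹∘θ d ⟨
    θ⁻¹ (θ d)  ≡⟨ cong θ⁻¹ (trans eq (sym θ-𝟎)) ⟩
    θ⁻¹ (θ 𝟎)  ≡⟨ θ⁻¹∘θ 𝟎 ⟩
    𝟎          ∎
    where open ≡-Reasoning

  x⊕θx≡𝟎⇒x≡𝟎 : ∀ {d} → d ⊕ θ d ≡ 𝟎 → d ≡ 𝟎
  x⊕θx≡𝟎⇒x≡𝟎 {d} eq = begin
    d                  ≡⟨ σ⁻¹∘σ d ⟨
    σ⁻¹ (d ⊕ θ d)      ≡⟨ cong σ⁻¹ (trans eq (sym σ-𝟎)) ⟩
    σ⁻¹ (𝟎 ⊕ θ 𝟎)      ≡⟨ σ⁻¹∘σ 𝟎 ⟩
    𝟎                  ∎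
    where open ≡-Reasoning

  independent : ∀ {d} → ¬ d ≡ 𝟎 → Π.Independent d
  independent d≢𝟎 false false _  = refl , refl
  independent d≢𝟎 true  false eq = ⊥-elim (d≢𝟎 (trans (sym (⊕-identityʳ _)) eq))
  independent d≢𝟎 false true  eq = ⊥-elim (d≢𝟎 (θx≡𝟎⇒x≡𝟎 (trans (sym (⊕-identityˡ _)) eq)))
  independent d≢𝟎 true  true  eq = ⊥-elim (d≢𝟎 (x⊕θx≡𝟎⇒x≡𝟎 eq))

  blocksAt : (d : Bits m) → Dec (d ≡ 𝟎) → Bits m → List (NestedBlock (2 ^ m))
  blocksAt d (yes _)   x = []
  blocksAt d (no d≢𝟎) x = if does (x ≟ Π.rep d x) then [ Π.block d (independent d≢𝟎) x ] else []

  design : List (NestedBlock (2 ^ m))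
  design = concatAll m λ d → concatAll m (blocksAt d (d ≟ 𝟎))

  count-design : (p : NestedBlock (2 ^ m) → Bool) →
                 count p design ≡ ∑ m (λ d → ∑ m (λ x → count p (blocksAt d (d ≟ 𝟎) x)))
  count-design p = trans (count-concatAll m p _) (∑-cong m (λ d → count-concatAll m p _))

  ∑-blocksAt : (p : NestedBlock (2 ^ m) → Bool) {d : Bits m} (d≢𝟎 : ¬ d ≡ 𝟎) (c : Bits m) (b : Bool) →
    (∀ x → does (x ≟ Π.rep d x) ∧ p (Π.block d (independent d≢𝟎) x) ≡ does (x ≟ c) ∧ b) →
    ∑ m (λ x → count p (blocksAt d (no d≢𝟎) x)) ≡ 𝟙 b
  ∑-blocksAt p d≢𝟎 c b canonical =
    trans (∑-cong m (λ x → trans (count-if p _ _) (cong 𝟙 (canonical x)))) (∑-δ-∧ m c b)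

  module _ {a b : Bits m} (a≢b : ¬ a ≡ b) where

    a⊕b≢𝟎 : ¬ a ⊕ b ≡ 𝟎
    a⊕b≢𝟎 = x≢y⇒x⊕y≢𝟎 a≢b

    pairs-through : ∀ d (d? : Dec (d ≡ 𝟎)) →
      ∑ m (λ x → count (pairInBlock (toFin a) (toFin b)) (blocksAt d d? x)) ≡ 𝟙 (does (Π._∈W*? d (a ⊕ b)))
    pairs-through d (no d≢𝟎)  =
      ∑-blocksAt _ d≢𝟎 _ _ (λ x → Π.pairInBlock-canonical d (independent d≢𝟎) x a≢b)
    pairs-through d (yes refl) = trans (∑-zero m) (cong 𝟙 (sym (dec-false (Π._∈W*? 𝟎 (a ⊕ b)) ∉W*)))
      where
      ∉W* : ¬ Π._∈W* 𝟎 (a ⊕ b)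
      ∉W* (inj₁ eq)        = a⊕b≢𝟎 eq
      ∉W* (inj₂ (inj₁ eq)) = a⊕b≢𝟎 (trans eq θ-𝟎)
      ∉W* (inj₂ (inj₂ eq)) = a⊕b≢𝟎 (trans eq σ-𝟎)

    parts-through : ∀ d (d? : Dec (d ≡ 𝟎)) →
      ∑ m (λ x → count (isPart (toFin a) (toFin b)) (blocksAt d d? x)) ≡ 𝟙 (does (d ≟ a ⊕ b))
    parts-through d (no d≢𝟎)  =
      ∑-blocksAt _ d≢𝟎 _ _ (λ x → Π.isPart-canonical d (independent d≢𝟎) x)
    parts-through d (yes refl) = trans (∑-zero m) (cong 𝟙 (sym (dec-false (𝟎 ≟ a ⊕ b) (a⊕b≢𝟎 ∘ sym))))

  ∈W*-count : ∀ {e} → ¬ e ≡ 𝟎 → ∀ d →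
    𝟙 (does (Π._∈W*? d e)) ≡ 𝟙 (does (d ≟ e)) + (𝟙 (does (d ≟ θ⁻¹ e)) + 𝟙 (does (d ≟ σ⁻¹ e)))
  ∈W*-count {e} e≢𝟎 d = begin
    𝟙 (does (e ≟ d ⊎-dec e ≟ θ d ⊎-dec e ≟ d ⊕ θ d))
      ≡⟨ 𝟙-⊎ (e ≟ d) (e ≟ θ d ⊎-dec e ≟ d ⊕ θ d) disjoint₁ ⟩
    𝟙 (does (e ≟ d)) + 𝟙 (does (e ≟ θ d ⊎-dec e ≟ d ⊕ θ d))
      ≡⟨ cong (𝟙 (does (e ≟ d)) +_) (𝟙-⊎ (e ≟ θ d) (e ≟ d ⊕ θ d) disjoint₂) ⟩
    𝟙 (does (e ≟ d)) + (𝟙 (does (e ≟ θ d)) + 𝟙 (does (e ≟ d ⊕ θ d)))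
      ≡⟨ cong₂ _+_ (𝟙-⇔ (mk⇔ sym sym) (e ≟ d) (d ≟ e))
                   (cong₂ _+_ (𝟙-⇔ θ⇔ (e ≟ θ d) (d ≟ θ⁻¹ e)) (𝟙-⇔ σ⇔ (e ≟ d ⊕ θ d) (d ≟ σ⁻¹ e))) ⟩
    𝟙 (does (d ≟ e)) + (𝟙 (does (d ≟ θ⁻¹ e)) + 𝟙 (does (d ≟ σ⁻¹ e)))
      ∎
    where
    open ≡-Reasoning
    disjoint₁ : ¬ (e ≡ d × (e ≡ θ d ⊎ e ≡ d ⊕ θ d))
    disjoint₁ (refl , inj₁ e≡θe)   = e≢𝟎 (x⊕θx≡𝟎⇒x≡𝟎 (trans (cong (e ⊕_) (sym e≡θe)) (⊕-self e)))
    disjoint₁ (refl , inj₂ e≡e⊕θe) = e≢𝟎 (θx≡𝟎⇒x≡𝟎 (trans (x⊕y≡z⇒y≡x⊕z (sym e≡e⊕θe)) (⊕-self e)))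
    disjoint₂ : ¬ (e ≡ θ d × e ≡ d ⊕ θ d)
    disjoint₂ (refl , θd≡d⊕θd) =
      e≢𝟎 (trans (cong θ d≡𝟎) θ-𝟎)
      where
      d≡𝟎 : d ≡ 𝟎
      d≡𝟎 = trans (x⊕y≡z⇒y≡x⊕z (trans (⊕-comm (θ d) d) (sym θd≡d⊕θd))) (⊕-self (θ d))
    θ⇔ : e ≡ θ d ⇔ d ≡ θ⁻¹ e
    θ⇔ = mk⇔ (λ eq → trans (sym (θ⁻¹∘θ d)) (cong θ⁻¹ (sym eq)))
             (λ eq → trans (sym (θ∘θ⁻¹ e)) (cong θ (sym eq)))
    σ⇔ : e ≡ d ⊕ θ d ⇔ d ≡ σ⁻¹ e
    σ⇔ = mk⇔ (λ eq → trans (sym (σ⁻¹∘σ d)) (cong σ⁻¹ (sym eq)))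
             (λ eq → trans (sym (σ∘σ⁻¹ e)) (cong (λ t → t ⊕ θ t) (sym eq)))

  pair-count : ∀ {a b} → ¬ a ≡ b → count (pairInBlock (toFin a) (toFin b)) design ≡ 3
  pair-count {a} {b} a≢b = begin
    count (pairInBlock (toFin a) (toFin b)) design
      ≡⟨ count-design _ ⟩
    ∑ m (λ d → ∑ m (λ x → count (pairInBlock (toFin a) (toFin b)) (blocksAt d (d ≟ 𝟎) x)))
      ≡⟨ ∑-cong m (λ d → trans (pairs-through a≢b d (d ≟ 𝟎)) (∈W*-count (x≢y⇒x⊕y≢𝟎 a≢b) d)) ⟩
    ∑ m (λ d → 𝟙 (does (d ≟ a ⊕ b)) + (𝟙 (does (d ≟ θ⁻¹ (a ⊕ b))) + 𝟙 (does (d ≟ σ⁻¹ (a ⊕ b)))))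
      ≡⟨ trans (∑-+ m _ _) (cong₂ _+_ (∑-δ m _) (trans (∑-+ m _ _) (cong₂ _+_ (∑-δ m _) (∑-δ m _)))) ⟩
    3 ∎
    where open ≡-Reasoning

  part-count : ∀ {a b} → ¬ a ≡ b → multiplicity design (toFin a) (toFin b) ≡ 1
  part-count {a} {b} a≢b =
    trans (count-design _) (trans (∑-cong m (λ d → parts-through a≢b d (d ≟ 𝟎))) (∑-δ m (a ⊕ b)))

  isNestedDesign : IsNestedDesign (2 ^ m) 3 design
  isNestedDesign = ∀-distinct-via-toFin (λ i j → count (pairInBlock i j) design ≡ 3) pair-count

  completelyUniform : CompletelyUniform design
  completelyUniform = 1 , s≤s z≤n , ∀-distinct-via-toFin (λ i j → multiplicity design i j ≡ 1) part-count

-- Orthomorphisms from 𝔽₄ and 𝔽₈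

∀-Bits? : ∀ m {P : Bits m → Set} → (∀ u → Dec (P u)) → Dec (∀ u → P u)
∀-Bits? zero    P? = map′ (λ p → λ { [] → p }) (λ h → h []) (P? [])
∀-Bits? (suc m) P? = map′
  (λ (f , t) → λ { (false ∷ u) → f u ; (true ∷ u) → t u })
  (λ h → (λ u → h (false ∷ u)) , (λ u → h (true ∷ u)))
  (∀-Bits? m (P? ∘ (false ∷_)) ×-dec ∀-Bits? m (P? ∘ (true ∷_)))

-- Multiplication by ω in 𝔽₄ = 𝔽₂(ω), in the basis 1, ω; as ω + 1 = ω² = ω⁻¹,
-- ×ω also inverts u ↦ u + ω u.
ω : Orthomorphism 2
ω = record
  { θ     = ×ω
  ; θ⁻¹   = ×ω²
  ; σ⁻¹   = ×ω
  ; θ⁻¹∘θ = from-yes (∀-Bits? 2 λ u → ×ω² (×ω u) ≟ u)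
  ; θ∘θ⁻¹ = from-yes (∀-Bits? 2 λ u → ×ω (×ω² u) ≟ u)
  ; σ⁻¹∘σ = from-yes (∀-Bits? 2 λ u → ×ω (u ⊕ ×ω u) ≟ u)
  ; σ∘σ⁻¹ = from-yes (∀-Bits? 2 λ u → ×ω u ⊕ ×ω (×ω u) ≟ u)
  ; θ-𝟎   = refl
  }
  where
  ×ω ×ω² : Bits 2 → Bits 2
  ×ω  (a ∷ b ∷ []) = b ∷ (a xor b) ∷ []
  ×ω² (a ∷ b ∷ []) = (a xor b) ∷ a ∷ []

-- Multiplication by a root ζ of X³ + X + 1 in 𝔽₈ = 𝔽₂(ζ), in the basis 1, ζ, ζ².
ζ : Orthomorphism 3
ζ = record
  { θ     = ×ζ
  ; θ⁻¹   = ×ζ⁻¹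
  ; σ⁻¹   = ×[ζ+1]⁻¹
  ; θ⁻¹∘θ = from-yes (∀-Bits? 3 λ u → ×ζ⁻¹ (×ζ u) ≟ u)
  ; θ∘θ⁻¹ = from-yes (∀-Bits? 3 λ u → ×ζ (×ζ⁻¹ u) ≟ u)
  ; σ⁻¹∘σ = from-yes (∀-Bits? 3 λ u → ×[ζ+1]⁻¹ (u ⊕ ×ζ u) ≟ u)
  ; σ∘σ⁻¹ = from-yes (∀-Bits? 3 λ u → ×[ζ+1]⁻¹ u ⊕ ×ζ (×[ζ+1]⁻¹ u) ≟ u)
  ; θ-𝟎   = refl
  }
  where
  ×ζ ×ζ⁻¹ ×[ζ+1]⁻¹ : Bits 3 → Bits 3
  ×ζ       (a ∷ b ∷ c ∷ []) = c ∷ (a xor c) ∷ b ∷ []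
  ×ζ⁻¹     (a ∷ b ∷ c ∷ []) = (a xor b) ∷ c ∷ a ∷ []
  ×[ζ+1]⁻¹ (a ∷ b ∷ c ∷ []) = (b xor c) ∷ (a xor b) ∷ (a xor b xor c) ∷ []

-- The maps of ω compute on a ∷ b ∷ [], so each law of ω⊞ o is the law of ω next to that of o.
ω⊞_ : Orthomorphism n → Orthomorphism (2 + n)
ω⊞ o = record
  { θ     = λ { (a ∷ b ∷ u) → ω.θ   (a ∷ b ∷ []) Vec.++ o.θ u }
  ; θ⁻¹   = λ { (a ∷ b ∷ u) → ω.θ⁻¹ (a ∷ b ∷ []) Vec.++ o.θ⁻¹ u }
  ; σ⁻¹   = λ { (a ∷ b ∷ u) → ω.σ⁻¹ (a ∷ b ∷ []) Vec.++ o.σ⁻¹ u }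
  ; θ⁻¹∘θ = λ { (a ∷ b ∷ u) → cong₂ Vec._++_ (ω.θ⁻¹∘θ (a ∷ b ∷ [])) (o.θ⁻¹∘θ u) }
  ; θ∘θ⁻¹ = λ { (a ∷ b ∷ u) → cong₂ Vec._++_ (ω.θ∘θ⁻¹ (a ∷ b ∷ [])) (o.θ∘θ⁻¹ u) }
  ; σ⁻¹∘σ = λ { (a ∷ b ∷ u) → cong₂ Vec._++_ (ω.σ⁻¹∘σ (a ∷ b ∷ [])) (o.σ⁻¹∘σ u) }
  ; σ∘σ⁻¹ = λ { (a ∷ b ∷ u) → cong₂ Vec._++_ (ω.σ∘σ⁻¹ (a ∷ b ∷ [])) (o.σ∘σ⁻¹ u) }
  ; θ-𝟎   = cong (λ u → false ∷ false ∷ u) o.θ-𝟎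
  }
  where
  module ω = Orthomorphism ω
  module o = Orthomorphism o

orthomorphism : ∀ n → Orthomorphism (2 + n)
orthomorphism zero          = ω
orthomorphism (suc zero)    = ζ
orthomorphism (suc (suc n)) = ω⊞ orthomorphism n

theorem4p7 : (m : ℕ) → 3 ≤ m →
    Σ (List (NestedBlock (2 ^ m)))
      (λ C → IsNestedDesign (2 ^ m) 3 C × CompletelyUniform C)
theorem4p7 (suc zero)    (s≤s ())
theorem4p7 (suc (suc n)) _ = design , isNestedDesign , completelyUniform
  where open Construction (orthomorphism n)
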